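{- Let $G=(V,E)$ be a connected simple graph with size $m=|E|>1$. Then \[ \gamma_{ct}(G) \leq m-\beta_1(G). \]
   Context: Two distinct edges are adjacent if they share a vertex. A set $F\subseteq E$ is an edge dominating set if every edge not in $F$ is adjacent to some edge of $F$. An edge dominating set $F$ is an edge cut dominating set if the spanning subgraph $(V,E\setminus F)$ is disconnected. The edge cut domination number $\gamma_{ct}(G)$ is the minimum cardinality of an edge cut dominating set of $G$. The matching number $\beta_1(G)$ is the maximum cardinality of a set of pairwise non-adjacent (independent) edges of $G$. -}

module Defs where

open import Data.Nat using (ℕ; _>_)
open import Data.Fin using (Fin)
open import Data.Fin.Subset using (Subset; _∈_; _∉_; ∁; ⊤)
open import Data.Product using (_×_; Σ; ∃; ∃-syntax; proj₁; proj₂; _,_)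
open import Data.Sum using (_⊎_)
open import Relation.Binary.PropositionalEquality using (_≡_; _≢_)
open import Relation.Nullary using (¬_)

record Graph : Set where
  field
    n    : ℕ
    m    : ℕ
    end₁ : Fin m → Fin n
    end₂ : Fin m → Fin n
    loopless : ∀ e → end₁ e ≢ end₂ e
    noParallel : ∀ e f → e ≢ f →
      ¬ ((end₁ e ≡ end₁ f × end₂ e ≡ end₂ f) ⊎ (end₁ e ≡ end₂ f × end₂ e ≡ end₁ f))

module _ (G : Graph) where
  open Graph G

  Incident : Fin n → Fin m → Set
  Incident v e = (v ≡ end₁ e) ⊎ (v ≡ end₂ e)

  Adjacent : Fin m → Fin m → Set
  Adjacent e f = e ≢ f × ∃[ v ] (Incident v e × Incident v f)

  data Reachable (S : Subset m) : Fin n → Fin n → Set where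
    here : ∀ {u} → Reachable S u u
    step : ∀ {u w} e → e ∈ S → Incident u e → Incident w e →
           ∀ {v} → Reachable S w v → Reachable S u v

  Connected : Subset m → Set
  Connected S = ∀ u v → Reachable S u v

  Disconnected : Subset m → Set
  Disconnected S = ∃[ u ] ∃[ v ] ¬ Reachable S u v

  IsConnected : Set
  IsConnected = Connected ⊤

  IsEdgeDominating : Subset m → Set
  IsEdgeDominating F = ∀ e → e ∉ F → ∃[ f ] (f ∈ F × Adjacent e f)

  IsEdgeCutDominating : Subset m → Set
  IsEdgeCutDominating F = IsEdgeDominating F × Disconnected (∁ F)

  IsMatching : Subset m → Set
  IsMatching M = ∀ e f → e ∈ M → f ∈ M → ¬ Adjacent e f

-- The complement of a matching M with β₁ edges is an edge cut dominating
-- set.  It dominates: a matching edge has an adjacent edge (G is connected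
-- with at least two edges), and that edge is outside M.  It is a cut: in
-- (V, M) two vertices are connected only if they are equal or matched, and
-- the endpoints of an edge outside M are neither, because G is simple.
module Submission where

open import Defs
open import Data.Nat using (ℕ; _≤_; _<_; _∸_; s≤s)
open import Data.Nat.Properties using (≤-reflexive)
open import Data.Fin using (Fin; zero; fromℕ<; punchIn; _≟_)
open import Data.Fin.Properties using (punchInᵢ≢i)
open import Data.Fin.Subset using (∣_∣; ∁; _∈_; _∉_; _⊆_)
open import Data.Fin.Subset.Properties
  using (x∈∁p⇒x∉p; x∉∁p⇒x∈p; x∉p⇒x∈∁p; ∣∁p∣≡n∸∣p∣; _∈?_)
open import Data.Product using (_×_; ∃-syntax; _,_; proj₂)
open import Data.Sum using (_⊎_; inj₁; inj₂)
open import Data.Empty using (⊥-elim)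
open import Function using (_∘_)
open import Relation.Nullary using (¬_; yes; no)
open import Relation.Binary.PropositionalEquality using (_≡_; _≢_; refl; sym; trans)

∃-other : ∀ {k} → 1 < k → (i : Fin k) → ∃[ j ] j ≢ i
∃-other (s≤s (s≤s _)) i = punchIn i zero , punchInᵢ≢i i zero

module _ (G : Graph) where
  open Graph G

  incident-ends⇒≡ : ∀ {h e} → Incident G (end₁ e) h → Incident G (end₂ e) h → h ≡ e
  incident-ends⇒≡ {h} {e} i₁ i₂ with h ≟ e
  ... | yes h≡e = h≡e
  ... | no  h≢e = ⊥-elim (noParallel h e h≢e (same-ends i₁ i₂))
    where
    same-ends : Incident G (end₁ e) h → Incident G (end₂ e) h →
      (end₁ h ≡ end₁ e × end₂ h ≡ end₂ e) ⊎ (end₁ h ≡ end₂ e × end₂ h ≡ end₁ e)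
    same-ends (inj₁ p) (inj₁ q) = ⊥-elim (loopless e (trans p (sym q)))
    same-ends (inj₁ p) (inj₂ q) = inj₁ (sym p , sym q)
    same-ends (inj₂ p) (inj₁ q) = inj₂ (sym q , sym p)
    same-ends (inj₂ p) (inj₂ q) = ⊥-elim (loopless e (trans p (sym q)))

  Reachable-mono : ∀ {S T u v} → S ⊆ T → Reachable G S u v → Reachable G T u v
  Reachable-mono S⊆T here                 = here
  Reachable-mono S⊆T (step e e∈S ue we r) = step e (S⊆T e∈S) ue we (Reachable-mono S⊆T r)

  -- The first edge of a path from e to another edge g that differs from e is adjacent to e.
  ∃-adjacent-on-path : ∀ {S u v} e g → g ≢ e → Incident G u e → Incident G v g →
    Reachable G S u v → ∃[ f ] Adjacent G e f
  ∃-adjacent-on-path {u = u} e g g≢e ue vg here = g , g≢e ∘ sym , u , ue , vg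
  ∃-adjacent-on-path {u = u} e g g≢e ue vg (step e′ _ ue′ we′ r) with e′ ≟ e
  ... | yes refl = ∃-adjacent-on-path e g g≢e we′ vg r
  ... | no e′≢e  = e′ , e′≢e ∘ sym , u , ue , ue′

  connected⇒∃-adjacent : IsConnected G → 1 < m → ∀ e → ∃[ f ] Adjacent G e f
  connected⇒∃-adjacent conn 1<m e with ∃-other 1<m e
  ... | g , g≢e = ∃-adjacent-on-path e g g≢e (inj₁ refl) (inj₁ refl) (conn (end₁ e) (end₁ g))

  reachable-in-matching : ∀ {M u v} → IsMatching G M → Reachable G M u v →
    u ≡ v ⊎ ∃[ h ] (h ∈ M × Incident G u h × Incident G v h)
  reachable-in-matching mat here = inj₁ refl
  reachable-in-matching mat (step e e∈M ue we r) with reachable-in-matching mat r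
  ... | inj₁ refl = inj₂ (e , e∈M , ue , we)
  ... | inj₂ (h , h∈M , wh , vh) with h ≟ e
  ...   | yes refl = inj₂ (h , h∈M , ue , vh)
  ...   | no  h≢e  = ⊥-elim (mat h e h∈M e∈M (h≢e , _ , wh , we))

  matching-disconnected : ∀ {M e} → IsMatching G M → e ∉ M → Disconnected G M
  matching-disconnected {M} {e} mat e∉M = end₁ e , end₂ e , unmatched ∘ reachable-in-matching mat
    where
    unmatched : ¬ (end₁ e ≡ end₂ e ⊎ ∃[ h ] (h ∈ M × Incident G (end₁ e) h × Incident G (end₂ e) h))
    unmatched (inj₁ loop)                 = loopless e loop
    unmatched (inj₂ (h , h∈M , i₁ , i₂)) with incident-ends⇒≡ i₁ i₂
    ... | refl = e∉M h∈M

  ∁-matching-dominating : ∀ {M} → IsMatching G M → (∀ e → ∃[ f ] Adjacent G e f) →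
    IsEdgeDominating G (∁ M)
  ∁-matching-dominating mat adj e e∉∁M with adj e
  ... | f , e~f = f , x∉p⇒x∈∁p (λ f∈M → mat e f (x∉∁p⇒x∈p e∉∁M) f∈M e~f) , e~f

  ∃-unmatched-edge : ∀ {M e f} → IsMatching G M → Adjacent G e f → ∃[ g ] g ∉ M
  ∃-unmatched-edge {M} {e} {f} mat e~f with e ∈? M
  ... | no  e∉M = e , e∉M
  ... | yes e∈M = f , λ f∈M → mat e f e∈M f∈M e~f

  Disconnected-∁∁ : ∀ {S} → Disconnected G S → Disconnected G (∁ (∁ S))
  Disconnected-∁∁ (u , v , u↛v) = u , v , u↛v ∘ Reachable-mono (x∉∁p⇒x∈p ∘ x∈∁p⇒x∉p)

mainTheorem1 : (G : Graph) → IsConnected G → 1 < Graph.m G →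
    (k : ℕ) →
    (∃[ M ] (IsMatching G M × ∣ M ∣ ≡ k)) →
    (∀ M → IsMatching G M → ∣ M ∣ ≤ k) →
    ∃[ F ] (IsEdgeCutDominating G F × ∣ F ∣ ≤ Graph.m G ∸ k)
mainTheorem1 G conn 1<m k (M , mat , refl) _ =
  ∁ M , (dominating , disconnected) , ≤-reflexive (∣∁p∣≡n∸∣p∣ M)
  where
  adj : ∀ e → ∃[ f ] Adjacent G e f
  adj = connected⇒∃-adjacent G conn 1<m

  dominating : IsEdgeDominating G (∁ M)
  dominating = ∁-matching-dominating G mat adj

  disconnected : Disconnected G (∁ (∁ M))
  disconnected with ∃-unmatched-edge G mat (proj₂ (adj (fromℕ< 1<m)))
  ... | _ , g∉M = Disconnected-∁∁ G (matching-disconnected G mat g∉M)
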